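{- For any two graphs $G$ and $H$, $f_{\text{opt}}(G\times H) \leq f_{\text{opt}}(G)\,f_{\text{opt}}(H)$.
   Context: Graphs are finite and connected. $G\times H$ denotes the Cartesian product: vertex set $V(G)\times V(H)$, with $(g_1,h_1)$ adjacent to $(g_2,h_2)$ iff either $g_1=g_2$ and $h_1h_2\in E(H)$, or $h_1=h_2$ and $g_1g_2\in E(G)$. A distribution of pebbles on a graph assigns a nonnegative integer number of pebbles to each vertex. A pebbling move removes two pebbles from a vertex and places one pebble on an adjacent vertex. A distribution is solvable if for every vertex $v$ there is a sequence (possibly empty) of pebbling moves after which $v$ has at least one pebble. The optimal pebbling number $f_{\text{opt}}(G)$ is the least number of pebbles in a solvable distribution on $G$. -}

module Defs where

open import Data.Nat using (ℕ; zero; suc; _+_; _*_; _∸_; _≤_)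
open import Data.Fin using (Fin; zero; suc; _≟_; remQuot)
open import Data.Bool using (if_then_else_)
open import Data.Product using (Σ; ∃; _×_; _,_; proj₁; proj₂)
open import Data.Sum using (_⊎_)
open import Relation.Nullary using (¬_)
open import Relation.Nullary.Decidable using (⌊_⌋)
open import Relation.Binary.PropositionalEquality using (_≡_)
open import Relation.Binary.Construct.Closure.ReflexiveTransitive using (Star)

record Graph : Set₁ where
  field
    n   : ℕ
    Adj : Fin n → Fin n → Set
open Graph public

record IsSimpleConnected (G : Graph) : Set where
  field
    symm      : ∀ {u v} → Adj G u v → Adj G v u
    irrefl    : ∀ {u} → ¬ Adj G u u
    connected : ∀ u v → Star (Adj G) u v

-- Cartesian product; vertex set Fin (n G * n H) ≅ Fin (n G) × Fin (n H) via remQuot/combine.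
_×ᴳ_ : Graph → Graph → Graph
G ×ᴳ H = record
  { n   = n G * n H
  ; Adj = λ x y →
      let gh₁ = remQuot (n H) x ; gh₂ = remQuot (n H) y
          g₁ = proj₁ gh₁ ; h₁ = proj₂ gh₁ ; g₂ = proj₁ gh₂ ; h₂ = proj₂ gh₂
      in (g₁ ≡ g₂ × Adj H h₁ h₂) ⊎ (h₁ ≡ h₂ × Adj G g₁ g₂)
  }

Distribution : Graph → Set
Distribution G = Fin (n G) → ℕ

size : ∀ {k} → (Fin k → ℕ) → ℕ
size {zero}  D = 0
size {suc k} D = D zero + size (λ i → D (suc i))

move : ∀ {k} → (Fin k → ℕ) → Fin k → Fin k → (Fin k → ℕ)
move D u v w = (if ⌊ w ≟ u ⌋ then D w ∸ 2 else D w) + (if ⌊ w ≟ v ⌋ then 1 else 0)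

data Step (G : Graph) : Distribution G → Distribution G → Set where
  step : ∀ {D u v} → Adj G u v → 2 ≤ D u → Step G D (move D u v)

Reachable : (G : Graph) → Distribution G → Distribution G → Set
Reachable G = Star (Step G)

Solvable : (G : Graph) → Distribution G → Set
Solvable G D = ∀ v → ∃ λ D' → Reachable G D D' × 1 ≤ D' v

IsOptPebbling : Graph → ℕ → Set
IsOptPebbling G k =
  (∃ λ D → Solvable G D × size D ≡ k) × (∀ D → Solvable G D → k ≤ size D)

{-# OPTIONS --safe #-}
module Submission where

-- If D and E are solvable distributions on G and H, then (g , h) ↦ D g * E h is solvable on
-- G × H and has |D| |E| pebbles. To reach (g* , h*), play in every layer G × {h} the
-- E h-fold multiple of a D-sequence that puts a pebble on g*; this leaves at least E h pebbles
-- on each (g* , h), i.e. a copy of E on the fibre {g*} × H, where an E-sequence reaching h*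
-- finishes. Everything rests on locality: a pebbling sequence stays playable when extra pebbles
-- lie elsewhere, so sequences can be scaled, run side by side and moved along graph embeddings.

open import Defs
open import Data.Nat using (ℕ; _*_; _≤_; zero; suc; _+_; _∸_; z≤n; >-nonZero)
open import Data.Nat.Properties
  using ( ≤-refl; ≤-reflexive; ≤-trans; +-assoc; +-identityʳ; *-zeroʳ; +-∸-assoc; ∸-monoˡ-≤
        ; +-monoˡ-≤; +-monoʳ-≤; m≤n+m; m≤m*n; *-comm; +-*-semiring; +-commutativeSemigroup)
open import Algebra.Properties.CommutativeSemigroup +-commutativeSemigroup using (x∙yz≈xz∙y; xy∙z≈xz∙y)
open import Algebra.Properties.Semiring.Sum +-*-semiring
  using (sum; sum-cong-≗; sum-remove; sum-replicate-zero; *-distribˡ-sum; *-distribʳ-sum)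
open import Data.Fin using (Fin; _≟_; remQuot; combine; _↑ˡ_; _↑ʳ_; punchIn) renaming (zero to fzero; suc to fsuc)
open import Data.Fin.Properties using (remQuot-combine; combine-remQuot; punchInᵢ≢i)
open import Data.Vec.Functional using (map; zipWith; removeAt)
open import Data.Vec.Functional.Relation.Binary.Pointwise using (Pointwise)
open import Data.Maybe using (Maybe; just; nothing; maybe′; when)
open import Data.Maybe.Properties using (just-injective)
open import Data.Product using (∃; _×_; _,_; proj₁; proj₂)
open import Data.Sum using (_⊎_; inj₁; inj₂)
open import Function using (_∘_; case_of_; Injective)
open import Relation.Nullary using (yes; no; contradiction)
open import Relation.Nullary.Decidable using (⌊_⌋)
open import Relation.Binary.PropositionalEquality
  using (_≡_; _≢_; refl; sym; trans; cong; cong₂; subst; subst₂; module ≡-Reasoning)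
open import Relation.Binary.Construct.Closure.ReflexiveTransitive using (ε; _◅_; _◅◅_)

private
  variable
    k m : ℕ
    G G′ : Graph

_≼_ : (Fin k → ℕ) → (Fin k → ℕ) → Set
_≼_ = Pointwise _≤_

_⊕_ : (Fin k → ℕ) → (Fin k → ℕ) → (Fin k → ℕ)
_⊕_ = zipWith _+_

_·_ : ℕ → (Fin k → ℕ) → (Fin k → ℕ)
c · D = map (c *_) D

⨁ : (Fin m → Fin k → ℕ) → (Fin k → ℕ)
⨁ Ds w = sum (λ i → Ds i w)

size≡sum : (F : Fin k → ℕ) → size F ≡ sum F
size≡sum {zero}  F = refl
size≡sum {suc k} F = cong (F fzero +_) (size≡sum (F ∘ fsuc))

sum-↑ : ∀ m {k} (F : Fin (m + k) → ℕ) → sum F ≡ sum (F ∘ (_↑ˡ k)) + sum (F ∘ (m ↑ʳ_))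
sum-↑ zero    F = refl
sum-↑ (suc m) F = trans (cong (F fzero +_) (sum-↑ m (F ∘ fsuc))) (sym (+-assoc (F fzero) _ _))

sum-combine : ∀ m {k} (F : Fin (m * k) → ℕ) → sum F ≡ sum {m} (λ i → sum {k} (λ j → F (combine i j)))
sum-combine zero        F = refl
sum-combine (suc m) {k} F =
  trans (sum-↑ k F) (cong (sum (F ∘ (_↑ˡ (m * k))) +_) (sum-combine m (F ∘ (k ↑ʳ_))))

sum-supported : (F : Fin k → ℕ) (i : Fin k) → (∀ j → j ≢ i → F j ≡ 0) → sum F ≡ F i
sum-supported {suc k} F i F≡0 = begin
  sum F                     ≡⟨ sum-remove {i = i} F ⟩
  F i + sum (removeAt F i)  ≡⟨ cong (F i +_) (sum-cong-≗ (λ j → F≡0 (punchIn i j) (punchInᵢ≢i i j))) ⟩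
  F i + sum {k} (λ _ → 0)   ≡⟨ cong (F i +_) (sum-replicate-zero k) ⟩
  F i + 0                   ≡⟨ +-identityʳ (F i) ⟩
  F i                       ∎
  where open ≡-Reasoning

+-frame : ∀ x {d p} b → x + d ≤ p → x + (d + b) ≤ p + b
+-frame x {d} b x+d≤p = ≤-trans (≤-reflexive (sym (+-assoc x d b))) (+-monoˡ-≤ b x+d≤p)

+-∸-frame : ∀ x {d p} b → 2 ≤ d → x + d ≤ p → x + (d ∸ 2 + b) ≤ p ∸ 2 + b
+-∸-frame x b 2≤d x+d≤p = +-frame x b (≤-trans (≤-reflexive (sym (+-∸-assoc x 2≤d))) (∸-monoˡ-≤ 2 x+d≤p))

move-frame : ∀ {D P : Fin k → ℕ} {u} v w x → 2 ≤ D u → x + D w ≤ P w → x + move D u v w ≤ move P u v w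
move-frame {u = u} v w x 2≤Du x+D≤P with w ≟ u
... | yes refl = +-∸-frame x _ 2≤Du x+D≤P
... | no _     = +-frame x _ x+D≤P

≟-injective : {f : Fin k → Fin m} → Injective _≡_ _≡_ f → ∀ x y → ⌊ f x ≟ f y ⌋ ≡ ⌊ x ≟ y ⌋
≟-injective {f = f} f-inj x y with f x ≟ f y | x ≟ y
... | yes _     | yes _   = refl
... | no _      | no _    = refl
... | yes fx≡fy | no x≢y  = contradiction (f-inj fx≡fy) x≢y
... | no fx≢fy  | yes x≡y = contradiction (cong f x≡y) fx≢fy

move-reindex : {f : Fin k → Fin m} → Injective _≡_ _≡_ f → ∀ {F D u v w} → F (f w) ≡ D w →
               move F (f u) (f v) (f w) ≡ move D u v w
move-reindex f-inj {u = u} {v} {w} Ffw≡Dw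
  rewrite ≟-injective f-inj w u | ≟-injective f-inj w v | Ffw≡Dw = refl

move-elsewhere : ∀ {F : Fin k → ℕ} {u v w} → w ≢ u → w ≢ v → move F u v w ≡ F w
move-elsewhere {F = F} {u} {v} {w} w≢u w≢v with w ≟ u | w ≟ v
... | no _      | no _      = +-identityʳ (F w)
... | yes w≡u   | _         = contradiction w≡u w≢u
... | no _      | yes w≡v   = contradiction w≡v w≢v

Covers : (G : Graph) → Distribution G → Distribution G → Set
Covers G P E = ∃ λ P′ → Reachable G P P′ × E ≼ P′

-- The pebbles D can be turned into (at least) E, whatever else lies on the graph.
_⊢_⇝_ : (G : Graph) → Distribution G → Distribution G → Set
G ⊢ D ⇝ E = ∀ X P → (X ⊕ D) ≼ P → Covers G P (X ⊕ E)

module _ {G : Graph} where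

  covers-mono : ∀ {P E E′} → E′ ≼ E → Covers G P E → Covers G P E′
  covers-mono E′≼E (P′ , P↠P′ , E≼P′) = P′ , P↠P′ , λ w → ≤-trans (E′≼E w) (E≼P′ w)

  ⇝⇒covers : ∀ {D E} → G ⊢ D ⇝ E → Covers G D E
  ⇝⇒covers D⇝E = D⇝E (λ _ → 0) _ (λ _ → ≤-refl)

  covers⇒reaches : ∀ {D E v} → Covers G D E → 1 ≤ E v → ∃ λ D′ → Reachable G D D′ × 1 ≤ D′ v
  covers⇒reaches (P , D↠P , E≼P) 1≤Ev = P , D↠P , ≤-trans 1≤Ev (E≼P _)

  ⇝-refl : ∀ {D} → G ⊢ D ⇝ D
  ⇝-refl X P X+D≼P = P , ε , X+D≼P

  ⇝-trans : ∀ {D E F} → G ⊢ D ⇝ E → G ⊢ E ⇝ F → G ⊢ D ⇝ F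
  ⇝-trans D⇝E E⇝F X P X+D≼P with D⇝E X P X+D≼P
  ... | P₁ , P↠P₁ , X+E≼P₁ with E⇝F X P₁ X+E≼P₁
  ... | P₂ , P₁↠P₂ , X+F≼P₂ = P₂ , P↠P₁ ◅◅ P₁↠P₂ , X+F≼P₂

  ⇝-mono : ∀ {D D′ E E′} → D ≼ D′ → E′ ≼ E → G ⊢ D ⇝ E → G ⊢ D′ ⇝ E′
  ⇝-mono D≼D′ E′≼E D⇝E X P X+D′≼P =
    covers-mono (λ w → +-monoʳ-≤ (X w) (E′≼E w))
                (D⇝E X P (λ w → ≤-trans (+-monoʳ-≤ (X w) (D≼D′ w)) (X+D′≼P w)))

  ⇝-⊕ : ∀ {D₁ D₂ E₁ E₂} → G ⊢ D₁ ⇝ E₁ → G ⊢ D₂ ⇝ E₂ → G ⊢ (D₁ ⊕ D₂) ⇝ (E₁ ⊕ E₂)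
  ⇝-⊕ {D₁} {D₂} {E₁} {E₂} D₁⇝E₁ D₂⇝E₂ X P X+D≼P
    with D₁⇝E₁ (X ⊕ D₂) P (λ w → ≤-trans (≤-reflexive (sym (x∙yz≈xz∙y (X w) (D₁ w) (D₂ w)))) (X+D≼P w))
  ... | P₁ , P↠P₁ , ≼P₁
    with D₂⇝E₂ (X ⊕ E₁) P₁ (λ w → ≤-trans (≤-reflexive (xy∙z≈xz∙y (X w) (E₁ w) (D₂ w))) (≼P₁ w))
  ... | P₂ , P₁↠P₂ , ≼P₂ =
    P₂ , P↠P₁ ◅◅ P₁↠P₂ , λ w → ≤-trans (≤-reflexive (sym (+-assoc (X w) (E₁ w) (E₂ w)))) (≼P₂ w)

  ⇝-· : ∀ c {D E} → G ⊢ D ⇝ E → G ⊢ (c · D) ⇝ (c · E)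
  ⇝-· zero    D⇝E = ⇝-refl
  ⇝-· (suc c) D⇝E = ⇝-⊕ D⇝E (⇝-· c D⇝E)

  ⇝-⨁ : ∀ {m} {Ds Es : Fin m → Distribution G} → (∀ i → G ⊢ Ds i ⇝ Es i) → G ⊢ ⨁ Ds ⇝ ⨁ Es
  ⇝-⨁ {zero}  Ds⇝Es = ⇝-refl
  ⇝-⨁ {suc m} Ds⇝Es = ⇝-⊕ (Ds⇝Es fzero) (⇝-⨁ (Ds⇝Es ∘ fsuc))

  step⇒⇝ : ∀ {D E} → Step G D E → G ⊢ D ⇝ E
  step⇒⇝ {D} (step {u = u} {v} u~v 2≤Du) X P X+D≼P =
    move P u v , step u~v 2≤Pu ◅ ε , λ w → move-frame {P = P} v w (X w) 2≤Du (X+D≼P w)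
    where
      2≤Pu : 2 ≤ P u
      2≤Pu = ≤-trans 2≤Du (≤-trans (m≤n+m (D u) (X u)) (X+D≼P u))

-- The partial inverse `from` makes the image decidable, which pushing distributions forward needs.
record Embedding (G G′ : Graph) : Set where
  field
    to      : Fin (n G) → Fin (n G′)
    from    : Fin (n G′) → Maybe (Fin (n G))
    from-to : ∀ g → from (to g) ≡ just g
    to-from : ∀ {y g} → from y ≡ just g → to g ≡ y
    adj     : ∀ {u v} → Adj G u v → Adj G′ (to u) (to v)

module _ (e : Embedding G G′) where
  open Embedding e

  push : Distribution G → Distribution G′
  push D y = maybe′ D 0 (from y)

  push-just : ∀ D {y g} → from y ≡ just g → push D y ≡ D g
  push-just D = cong (maybe′ D 0)

  push-nothing : ∀ D {y} → from y ≡ nothing → push D y ≡ 0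
  push-nothing D = cong (maybe′ D 0)

  to-injective : Injective _≡_ _≡_ to
  to-injective {g} {g′} to-g≡to-g′ =
    just-injective (trans (sym (from-to g)) (trans (cong from to-g≡to-g′) (from-to g′)))

  outside-image : ∀ {y} g → from y ≡ nothing → y ≢ to g
  outside-image g from-y≡nothing refl with () ← trans (sym (from-to g)) from-y≡nothing

  image-or-outside : ∀ y → (∃ λ g → from y ≡ just g) ⊎ from y ≡ nothing
  image-or-outside y with from y
  ... | just g  = inj₁ (g , refl)
  ... | nothing = inj₂ refl

  push-move : ∀ D u v y → push (move D u v) y ≡ move (push D) (to u) (to v) y
  push-move D u v y with image-or-outside y
  ... | inj₁ (g , from-y) = begin
    push (move D u v) y                  ≡⟨ push-just (move D u v) from-y ⟩
    move D u v g                         ≡⟨ move-reindex to-injective {push D} {D} (push-just D (from-to g)) ⟨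
    move (push D) (to u) (to v) (to g)   ≡⟨ cong (move (push D) (to u) (to v)) (to-from from-y) ⟩
    move (push D) (to u) (to v) y        ∎
    where open ≡-Reasoning
  ... | inj₂ from-y = begin
    push (move D u v) y             ≡⟨ push-nothing (move D u v) from-y ⟩
    0                               ≡⟨ push-nothing D from-y ⟨
    push D y                        ≡⟨ move-elsewhere {F = push D} (outside-image u from-y) (outside-image v from-y) ⟨
    move (push D) (to u) (to v) y   ∎
    where open ≡-Reasoning

  push-step : ∀ {D E} → Step G D E → G′ ⊢ push D ⇝ push E
  push-step {D} (step {u = u} {v} u~v 2≤Du) =
    ⇝-mono (λ _ → ≤-refl) (λ y → ≤-reflexive (push-move D u v y))
           (step⇒⇝ (step (adj u~v) (≤-trans 2≤Du (≤-reflexive (sym (push-just D (from-to u)))))))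

  push-reachable : ∀ {D E} → Reachable G D E → G′ ⊢ push D ⇝ push E
  push-reachable ε              = ⇝-refl
  push-reachable (D→D′ ◅ D′↠E) = ⇝-trans (push-step D→D′) (push-reachable D′↠E)

module _ {A : Set} {a : A} where

  when-≟-refl : (i : Fin k) → when ⌊ i ≟ i ⌋ a ≡ just a
  when-≟-refl i with i ≟ i
  ... | yes _   = refl
  ... | no i≢i = contradiction refl i≢i

module _ {A : Set} {i j : Fin k} {a : A} where

  when-≟-≢ : i ≢ j → when ⌊ i ≟ j ⌋ a ≡ nothing
  when-≟-≢ i≢j with i ≟ j
  ... | yes i≡j = contradiction i≡j i≢j
  ... | no _    = refl

  when-≟-just : ∀ {b} → when ⌊ i ≟ j ⌋ a ≡ just b → i ≡ j × a ≡ b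
  when-≟-just eq with i ≟ j
  when-≟-just refl | yes i≡j = i≡j , refl

module Product (G H : Graph) where

  private
    π₁ : Fin (n G * n H) → Fin (n G)
    π₁ y = proj₁ (remQuot {n G} (n H) y)

    π₂ : Fin (n G * n H) → Fin (n H)
    π₂ y = proj₂ (remQuot {n G} (n H) y)

    combine-π : ∀ {y g h} → π₁ y ≡ g → π₂ y ≡ h → combine g h ≡ y
    combine-π {y} refl refl = combine-remQuot {n G} (n H) y

  ×ᴳ-adj : ∀ {g₁ g₂ h₁ h₂} → (g₁ ≡ g₂ × Adj H h₁ h₂) ⊎ (h₁ ≡ h₂ × Adj G g₁ g₂) →
           Adj (G ×ᴳ H) (combine g₁ h₁) (combine g₂ h₂)
  ×ᴳ-adj {g₁} {g₂} {h₁} {h₂} =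
    subst₂ (λ (g₁ , h₁) (g₂ , h₂) → (g₁ ≡ g₂ × Adj H h₁ h₂) ⊎ (h₁ ≡ h₂ × Adj G g₁ g₂))
           (sym (remQuot-combine g₁ h₁)) (sym (remQuot-combine g₂ h₂))

  layerᴳ : Fin (n H) → Embedding G (G ×ᴳ H)
  layerᴳ h = record
    { to      = λ g → combine g h
    ; from    = λ y → when ⌊ π₂ y ≟ h ⌋ (π₁ y)
    ; from-to = λ g → trans (cong (λ (g′ , h′) → when ⌊ h′ ≟ h ⌋ g′) (remQuot-combine g h)) (when-≟-refl h)
    ; to-from = λ from-y → let (π₂≡h , π₁≡g) = when-≟-just from-y in combine-π π₁≡g π₂≡h
    ; adj     = λ u~v → ×ᴳ-adj (inj₂ (refl , u~v))
    }

  layerᴴ : Fin (n G) → Embedding H (G ×ᴳ H)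
  layerᴴ g = record
    { to      = λ h → combine g h
    ; from    = λ y → when ⌊ π₁ y ≟ g ⌋ (π₂ y)
    ; from-to = λ h → trans (cong (λ (g′ , h′) → when ⌊ g′ ≟ g ⌋ h′) (remQuot-combine g h)) (when-≟-refl g)
    ; to-from = λ from-y → let (π₁≡g , π₂≡h) = when-≟-just from-y in combine-π π₁≡g π₂≡h
    ; adj     = λ u~v → ×ᴳ-adj (inj₁ (refl , u~v))
    }

  ⨁-layersᴳ : (c : Fin (n H) → ℕ) (D : Distribution G) (y : Fin (n G * n H)) →
              ⨁ (λ h → c h · push (layerᴳ h) D) y ≡ c (π₂ y) * D (π₁ y)
  ⨁-layersᴳ c D y = begin
    sum (λ h → c h * push (layerᴳ h) D y)  ≡⟨ sum-supported _ (π₂ y) off-layer ⟩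
    c (π₂ y) * push (layerᴳ (π₂ y)) D y    ≡⟨ cong (c (π₂ y) *_) (push-just (layerᴳ _) D (when-≟-refl (π₂ y))) ⟩
    c (π₂ y) * D (π₁ y)                    ∎
    where
      open ≡-Reasoning
      off-layer : ∀ h → h ≢ π₂ y → c h * push (layerᴳ h) D y ≡ 0
      off-layer h h≢π₂y = begin
        c h * push (layerᴳ h) D y  ≡⟨ cong (c h *_) (push-nothing (layerᴳ h) D (when-≟-≢ (h≢π₂y ∘ sym))) ⟩
        c h * 0                    ≡⟨ *-zeroʳ (c h) ⟩
        0                          ∎

  _⊗_ : Distribution G → Distribution H → Distribution (G ×ᴳ H)
  (DG ⊗ DH) y = DG (π₁ y) * DH (π₂ y)

  size-⊗ : (DG : Distribution G) (DH : Distribution H) → size (DG ⊗ DH) ≡ size DG * size DH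
  size-⊗ DG DH = begin
    size (DG ⊗ DH)                                 ≡⟨ size≡sum (DG ⊗ DH) ⟩
    sum (DG ⊗ DH)                                  ≡⟨ sum-combine (n G) {n H} (DG ⊗ DH) ⟩
    sum (λ g → sum (λ h → (DG ⊗ DH) (combine {n G} g h))) ≡⟨ sum-cong-≗ (λ g → sum-cong-≗ (λ h → ⊗-combine g h)) ⟩
    sum (λ g → sum (λ h → DG g * DH h))            ≡⟨ sum-cong-≗ (λ g → *-distribˡ-sum (DG g) DH) ⟨
    sum (λ g → DG g * sum DH)                      ≡⟨ *-distribʳ-sum (sum DH) DG ⟨
    sum DG * sum DH                                ≡⟨ cong₂ _*_ (size≡sum DG) (size≡sum DH) ⟨
    size DG * size DH                              ∎
    where
      open ≡-Reasoning
      ⊗-combine : ∀ g h → (DG ⊗ DH) (combine g h) ≡ DG g * DH h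
      ⊗-combine g h = cong (λ (g′ , h′) → DG g′ * DH h′) (remQuot-combine g h)

  ⊗-⇝-fibre : ∀ {DG EG : Distribution G} {DH : Distribution H} {g} → Reachable G DG EG → 1 ≤ EG g →
              (G ×ᴳ H) ⊢ DG ⊗ DH ⇝ push (layerᴴ g) DH
  ⊗-⇝-fibre {DG} {EG} {DH} {g} DG↠EG 1≤EGg =
    ⇝-mono (λ y → ≤-reflexive (trans (⨁-layersᴳ DH DG y) (*-comm (DH (π₂ y)) (DG (π₁ y)))))
           fibre≼layers
           (⇝-⨁ (λ h → ⇝-· (DH h) (push-reachable (layerᴳ h) DG↠EG)))
    where
      fibre≼layers : push (layerᴴ g) DH ≼ ⨁ (λ h → DH h · push (layerᴳ h) EG)
      fibre≼layers y rewrite ⨁-layersᴳ DH EG y = case π₁ y ≟ g of λ where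
        (yes refl) → ≤-trans (≤-reflexive (push-just (layerᴴ g) DH (when-≟-refl g)))
                             (m≤m*n (DH (π₂ y)) (EG g) {{>-nonZero 1≤EGg}})
        (no π₁y≢g) → ≤-trans (≤-reflexive (push-nothing (layerᴴ g) DH (when-≟-≢ π₁y≢g))) z≤n

  ⊗-solvable : ∀ {DG DH} → Solvable G DG → Solvable H DH → Solvable (G ×ᴳ H) (DG ⊗ DH)
  ⊗-solvable solves-G solves-H y with solves-G (π₁ y) | solves-H (π₂ y)
  ... | EG , DG↠EG , 1≤EG | EH , DH↠EH , 1≤EH =
    covers⇒reaches (⇝⇒covers (⇝-trans (⊗-⇝-fibre DG↠EG 1≤EG) (push-reachable (layerᴴ (π₁ y)) DH↠EH)))
                   (≤-trans 1≤EH (≤-reflexive (sym (push-just (layerᴴ (π₁ y)) EH (when-≟-refl (π₁ y))))))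

theorem3 : (G H : Graph) → IsSimpleConnected G → IsSimpleConnected H →
           (a b c : ℕ) → IsOptPebbling G a → IsOptPebbling H b →
           IsOptPebbling (G ×ᴳ H) c → c ≤ a * b
theorem3 G H _ _ a b c ((DG , solves-G , refl) , _) ((DH , solves-H , refl) , _) (_ , c-minimal) =
  subst (c ≤_) (size-⊗ DG DH) (c-minimal (DG ⊗ DH) (⊗-solvable solves-G solves-H))
  where open Product G H
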